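{- Suppose $\mathcal{V}$ is a P-point and $\mathcal{U}$ is any ultrafilter on $\omega$, and suppose $\phi:\mathcal{V}\to\mathcal{U}$ is monotone and cofinal in $\mathcal{U}$. Then there exist $P\subseteq[\omega]^{<\omega}\setminus\{\emptyset\}$ and $f:P\to\omega$ such that: (1) for all $s,t\in P$, if $s\subseteq t$ then $s=t$; (2) $f$ is finite-to-one; (3) for every $a\in\mathcal{V}$ and every $b\in\mathcal{U}$ there is $s\in P$ with $s\subseteq a$ and $f(s)\in b$.
   Context: Ultrafilters on $\omega$ are non-principal. $[\omega]^{<\omega}$ is the set of finite subsets of $\omega$. An ultrafilter $\mathcal{V}$ is a P-point if for every $f:\omega\to\omega$ there is $A\in\mathcal{V}$ on which $f$ is finite-to-one or constant. A map $\phi:\mathcal{V}\to\mathcal{U}$ is monotone if $a\subseteq b$ implies $\phi(a)\subseteq\phi(b)$, and cofinal in $\mathcal{U}$ if for every $b\in\mathcal{U}$ there is $a\in\mathcal{V}$ with $\phi(a)\subseteq b$. -}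

module Defs where

open import Data.Nat using (ℕ; zero; suc; _<_; _/_; _%_)
open import Data.Nat.Properties using (_≟_)
open import Data.Bool using (Bool; true; false; not; _∧_)
open import Data.Product using (Σ; _×_; ∃; ∃-syntax)
open import Data.Sum using (_⊎_)
open import Relation.Nullary using (¬_; does)
open import Relation.Binary.PropositionalEquality using (_≡_)

Subset : Set
Subset = ℕ → Bool

_∈ˢ_ : ℕ → Subset → Set
n ∈ˢ A = A n ≡ true

_⊆ˢ_ : Subset → Subset → Set
A ⊆ˢ B = ∀ n → n ∈ˢ A → n ∈ˢ B

full : Subset
full _ = true

empty : Subset
empty _ = false

_∩ˢ_ : Subset → Subset → Subset
(A ∩ˢ B) n = A n ∧ B n

compl : Subset → Subset
compl A n = not (A n)

singleton : ℕ → Subset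
singleton m n = does (m ≟ n)

record IsUltrafilter (U : Subset → Set) : Set where
  field
    full∈      : U full
    empty∉     : ¬ U empty
    upward     : ∀ A B → U A → A ⊆ˢ B → U B
    inter      : ∀ A B → U A → U B → U (A ∩ˢ B)
    ultra      : ∀ A → U A ⊎ U (compl A)
    nonPrinc   : ∀ n → ¬ U (singleton n)

FiniteToOneOn : Subset → (ℕ → ℕ) → Set
FiniteToOneOn A g = ∀ k → ∃[ B ] (∀ m → m ∈ˢ A → g m ≡ k → m < B)

ConstantOn : Subset → (ℕ → ℕ) → Set
ConstantOn A g = ∃[ c ] (∀ m → m ∈ˢ A → g m ≡ c)

IsPPoint : (Subset → Set) → Set
IsPPoint V = IsUltrafilter V ×
  (∀ (g : ℕ → ℕ) → ∃[ A ] (V A × (FiniteToOneOn A g ⊎ ConstantOn A g)))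

-- φ : V → U (given as a total map on subsets; only its values on V matter).
MapsInto : (Subset → Set) → (Subset → Set) → (Subset → Subset) → Set
MapsInto V U φ = ∀ a → V a → U (φ a)

MonotoneOn : (Subset → Set) → (Subset → Subset) → Set
MonotoneOn V φ = ∀ a b → V a → V b → a ⊆ˢ b → φ a ⊆ˢ φ b

CofinalIn : (Subset → Set) → (Subset → Set) → (Subset → Subset) → Set
CofinalIn V U φ = ∀ b → U b → ∃[ a ] (V a × φ a ⊆ˢ b)

-- Finite subsets of ω coded by natural numbers (binary expansion):
-- k belongs to the finite set coded by s iff the k-th binary digit of s is 1.
-- This coding is a bijection between ℕ and [ω]^{<ω}.
bit : ℕ → ℕ → Bool
bit s zero = does (s % 2 ≟ 1)
bit s (suc k) = bit (s / 2) k

_∈ᶠ_ : ℕ → ℕ → Set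
k ∈ᶠ s = bit s k ≡ true

_⊆ᶠ_ : ℕ → ℕ → Set
s ⊆ᶠ t = ∀ k → k ∈ᶠ s → k ∈ᶠ t

NonEmptyᶠ : ℕ → Set
NonEmptyᶠ s = ∃[ k ] (k ∈ᶠ s)

_⊆ᶠˢ_ : ℕ → Subset → Set
s ⊆ᶠˢ a = ∀ k → k ∈ᶠ s → k ∈ˢ a

FiniteToOneOnP : (ℕ → Set) → (ℕ → ℕ) → Set
FiniteToOneOnP P f = ∀ n → ∃[ B ] (∀ s → P s → f s ≡ n → s < B)

-- For a finite set c and m ∈ ω, choose if possible a set Y(c,m) ∈ V with m ∉ φ(c ∪ Y(c,m)), and let
-- W k be the intersection of the Y(c,m) with c ⊆ [0,k), m ≤ k.  The P-point property, applied to
-- g x = the first k with x ∉ W k (which cannot be constant on a set in V), yields X ∈ V and K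
-- with m ≤ K m and X ∖ [0, K m) ⊆ W (K m).
-- Then for a ⊆ X in V and m ∈ φ a, the finite set a ∩ [0, K m) alone forces m into φ a' for every
-- a' ∈ V containing it: otherwise a' would be such a Y, and monotonicity applied to a ⊆ c ∪ Y(c,m)
-- gives a contradiction.  P consists of the ⊆-minimal finite sets s forcing some m with s ⊆ [0, K m),
-- f picks such an m, and f is finite-to-one because f s = m bounds s by 2 ^ K m.

module Submission where

open import Defs
open import Data.Nat using (ℕ; zero; suc; _+_; _*_; _^_; _≤_; _<_; z≤n; s≤s; _⊔_; _/_; _%_; _<?_; _≤?_)
open import Data.Nat.Properties
open import Data.Nat.DivMod
open import Data.Nat.Induction using (<-wellFounded)
open import Induction.WellFounded using (Acc; acc)
open import Data.Bool using (Bool; true; false; not; _∧_; _∨_)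
open import Data.Product using (Σ; _×_; ∃; ∃-syntax; _,_; proj₁; proj₂)
open import Data.Sum using (_⊎_; inj₁; inj₂; [_,_]′)
open import Data.Empty using (⊥-elim)
open import Function using (_∘_)
open import Relation.Nullary using (¬_; Dec; yes; no; does)
open import Relation.Nullary.Decidable using (dec-true)
open import Relation.Binary.PropositionalEquality using (_≡_; refl; sym; trans; cong; subst; module ≡-Reasoning)
open import Relation.Binary.Definitions using (tri<; tri≈; tri>)
open import Level using (0ℓ)
open import Axiom.ExcludedMiddle using (ExcludedMiddle)

does-true⇒ : ∀ {P : Set} (d : Dec P) → does d ≡ true → P
does-true⇒ (yes p) _ = p

does-not⇒¬ : ∀ {P : Set} (d : Dec P) → not (does d) ≡ true → ¬ P
does-not⇒¬ (no ¬p) _ = ¬p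

∧-true⁻ : ∀ {a b} → (a ∧ b) ≡ true → a ≡ true × b ≡ true
∧-true⁻ {true} p = refl , p

∨-true⁻ : ∀ {a b} → (a ∨ b) ≡ true → a ≡ true ⊎ b ≡ true
∨-true⁻ {true} _ = inj₁ refl
∨-true⁻ {false} p = inj₂ p

∨-true⁺ˡ : ∀ {a b} → a ≡ true → (a ∨ b) ≡ true
∨-true⁺ˡ refl = refl

∨-true⁺ʳ : ∀ {a b} → b ≡ true → (a ∨ b) ≡ true
∨-true⁺ʳ {true} _ = refl
∨-true⁺ʳ {false} p = p

pushBit : Bool → ℕ → ℕ
pushBit false r = r * 2
pushBit true r = suc (r * 2)

bit-pushBit-zero : ∀ b r → bit (pushBit b r) 0 ≡ b
bit-pushBit-zero false r = cong (λ q → does (q ≟ 1)) (m*n%n≡0 r 2)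
bit-pushBit-zero true r = cong (λ q → does (q ≟ 1)) ([m+kn]%n≡m%n 1 r 2)

pushBit-/2 : ∀ b r → pushBit b r / 2 ≡ r
pushBit-/2 false r = m*n/n≡m r 2
pushBit-/2 true r = trans (+-distrib-/ 1 (r * 2) 1+0<2) (m*n/n≡m r 2)
  where
  1+0<2 : 1 % 2 + r * 2 % 2 < 2
  1+0<2 = subst (λ q → 1 + q < 2) (sym (m*n%n≡0 r 2)) ≤-refl

bit-pushBit-suc : ∀ b r i → bit (pushBit b r) (suc i) ≡ bit r i
bit-pushBit-suc b r i = cong (λ q → bit q i) (pushBit-/2 b r)

pushBit-< : ∀ b {r} k → r < 2 ^ k → pushBit b r < 2 ^ suc k
pushBit-< b {r} k r<2^k = ≤-trans (pushBit≤ b) 2r+2≤2^k*2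
  where
  pushBit≤ : ∀ b → pushBit b r < suc (suc (r * 2))
  pushBit≤ false = n≤1+n _
  pushBit≤ true = ≤-refl
  2r+2≤2^k*2 : suc (suc (r * 2)) ≤ 2 ^ suc k
  2r+2≤2^k*2 = subst (suc (suc (r * 2)) ≤_) (*-comm (2 ^ k) 2) (*-monoˡ-≤ 2 r<2^k)

bit-zero : ∀ i → bit 0 i ≡ false
bit-zero zero = refl
bit-zero (suc i) = bit-zero i

prefixCode : Subset → ℕ → ℕ
prefixCode a zero = 0
prefixCode a (suc k) = pushBit (a 0) (prefixCode (a ∘ suc) k)

∈ᶠ-prefixCode⁻ : ∀ a k i → i ∈ᶠ prefixCode a k → i < k × i ∈ˢ a
∈ᶠ-prefixCode⁻ a zero i i∈ with trans (sym i∈) (bit-zero i)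
... | ()
∈ᶠ-prefixCode⁻ a (suc k) zero i∈ = s≤s z≤n , trans (sym (bit-pushBit-zero (a 0) _)) i∈
∈ᶠ-prefixCode⁻ a (suc k) (suc i) i∈
  with ∈ᶠ-prefixCode⁻ (a ∘ suc) k i (trans (sym (bit-pushBit-suc (a 0) _ i)) i∈)
... | i<k , i∈a = s≤s i<k , i∈a

∈ᶠ-prefixCode⁺ : ∀ a k i → i < k → i ∈ˢ a → i ∈ᶠ prefixCode a k
∈ᶠ-prefixCode⁺ a (suc k) zero _ i∈a = trans (bit-pushBit-zero (a 0) _) i∈a
∈ᶠ-prefixCode⁺ a (suc k) (suc i) (s≤s i<k) i∈a =
  trans (bit-pushBit-suc (a 0) _ i) (∈ᶠ-prefixCode⁺ (a ∘ suc) k i i<k i∈a)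

prefixCode-< : ∀ a k → prefixCode a k < 2 ^ k
prefixCode-< a zero = s≤s z≤n
prefixCode-< a (suc k) = pushBit-< (a 0) k (prefixCode-< (a ∘ suc) k)

%2-mono : ∀ s t → (0 ∈ᶠ s → 0 ∈ᶠ t) → s % 2 ≤ t % 2
%2-mono s t 0∈s⇒0∈t with s % 2 | m%n<n s 2
... | zero | _ = z≤n
... | suc zero | _ = ≤-reflexive (sym (does-true⇒ (t % 2 ≟ 1) (0∈s⇒0∈t refl)))
... | suc (suc _) | s≤s (s≤s ())

⊆ᶠ⇒≤ : ∀ {s t} → s ⊆ᶠ t → s ≤ t
⊆ᶠ⇒≤ {s} = go s (<-wellFounded s)
  where
  go : ∀ s {t} → Acc _<_ s → s ⊆ᶠ t → s ≤ t
  go zero _ _ = z≤n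
  go s@(suc _) {t} (acc rec) s⊆t = begin
    s                   ≡⟨ m≡m%n+[m/n]*n s 2 ⟩
    s % 2 + s / 2 * 2   ≤⟨ +-mono-≤ (%2-mono s t (s⊆t 0)) (*-monoˡ-≤ 2 s/2≤t/2) ⟩
    t % 2 + t / 2 * 2   ≡⟨ m≡m%n+[m/n]*n t 2 ⟨
    t                   ∎
    where
    open ≤-Reasoning
    s/2≤t/2 : s / 2 ≤ t / 2
    s/2≤t/2 = go (s / 2) (rec (m/n<m s 2 (s≤s (s≤s z≤n)))) (s⊆t ∘ suc)

firstFalse : (ℕ → Bool) → ℕ → ℕ
firstFalse p zero = zero
firstFalse p (suc n) with p 0
... | true = suc (firstFalse (p ∘ suc) n)
... | false = zero

firstFalse-minimal : ∀ p n k → k < firstFalse p n → p k ≡ true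
firstFalse-minimal p (suc n) k k< with p 0 in p0
firstFalse-minimal p (suc n) zero _ | true = p0
firstFalse-minimal p (suc n) (suc k) (s≤s k<) | true = firstFalse-minimal (p ∘ suc) n k k<

firstFalse-found : ∀ p n → firstFalse p n < n → p (firstFalse p n) ≡ false
firstFalse-found p (suc n) f<n with p 0 in p0
... | true = firstFalse-found (p ∘ suc) n (≤-pred f<n)
... | false = p0

choice : {A : Set} {B : A → Set} → A → Dec (Σ A B) → A
choice _ (yes (a , _)) = a
choice a₀ (no _) = a₀

choice-correct : {A : Set} {B : A → Set} {a₀ : A} (d : Dec (Σ A B)) → Σ A B → B (choice a₀ d)
choice-correct (yes (_ , b)) _ = b
choice-correct (no ∄) ∃b = ⊥-elim (∄ ∃b)

choice-preserves : {A : Set} {B : A → Set} {a₀ : A} (Q : A → Set) →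
  Q a₀ → (∀ a → B a → Q a) → (d : Dec (Σ A B)) → Q (choice a₀ d)
choice-preserves Q Qa₀ _ (no _) = Qa₀
choice-preserves Q _ B⇒Q (yes (a , b)) = B⇒Q a b

Minimal : (ℕ → Set) → ℕ → Set
Minimal S t = S t × (∀ u → S u → u ⊆ᶠ t → u ≡ t)

minimal-⊆ᶠ : ExcludedMiddle 0ℓ → (S : ℕ → Set) → ∀ s → S s → ∃[ t ] (Minimal S t × t ⊆ᶠ s)
minimal-⊆ᶠ em S s = go s (<-wellFounded s)
  where
  go : ∀ s → Acc _<_ s → S s → ∃[ t ] (Minimal S t × t ⊆ᶠ s)
  go s (acc rec) Ss with em {∃[ u ] (S u × u ⊆ᶠ s × ¬ u ≡ s)}
  ... | yes (u , Su , u⊆s , u≢s) with go u (rec (≤∧≢⇒< (⊆ᶠ⇒≤ u⊆s) u≢s)) Su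
  ...   | t , min-t , t⊆u = t , min-t , λ k k∈t → u⊆s k (t⊆u k k∈t)
  go s _ Ss | no ∄smaller = s , (Ss , minimal) , λ _ k∈s → k∈s
    where
    minimal : ∀ u → S u → u ⊆ᶠ s → u ≡ s
    minimal u Su u⊆s with u ≟ s
    ... | yes u≡s = u≡s
    ... | no u≢s = ⊥-elim (∄smaller (u , Su , u⊆s , u≢s))

finiteToOne⇒bounded : ∀ {A g} → FiniteToOneOn A g → ∀ j → ∃[ C ] (∀ x → x ∈ˢ A → g x ≤ j → x < C)
finiteToOne⇒bounded fto zero = proj₁ (fto 0) , λ x x∈A gx≤0 → proj₂ (fto 0) x x∈A (n≤0⇒n≡0 gx≤0)
finiteToOne⇒bounded {A} {g} fto (suc j) = B ⊔ C , bounded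
  where
  B C : ℕ
  B = proj₁ (fto (suc j))
  C = proj₁ (finiteToOne⇒bounded fto j)
  bounded : ∀ x → x ∈ˢ A → g x ≤ suc j → x < B ⊔ C
  bounded x x∈A gx≤1+j with m≤n⇒m<n∨m≡n gx≤1+j
  ... | inj₁ gx<1+j = ≤-trans (proj₂ (finiteToOne⇒bounded fto j) x x∈A (≤-pred gx<1+j)) (m≤n⊔m B C)
  ... | inj₂ gx≡1+j = ≤-trans (proj₂ (fto (suc j)) x x∈A gx≡1+j) (m≤m⊔n B C)

⋂< : ℕ → (ℕ → Subset) → Subset
⋂< zero Z = full
⋂< (suc N) Z = ⋂< N Z ∩ˢ Z N

∈-⋂< : ∀ N Z x → x ∈ˢ ⋂< N Z → ∀ i → i < N → x ∈ˢ Z i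
∈-⋂< (suc N) Z x x∈ i i<1+N with ∧-true⁻ {⋂< N Z x} x∈ | m≤n⇒m<n∨m≡n (≤-pred i<1+N)
... | x∈⋂ , _ | inj₁ i<N = ∈-⋂< N Z x x∈⋂ i i<N
... | _ , x∈Z | inj₂ refl = x∈Z

below : ℕ → Subset
below k x = does (x <? k)

-- The blocks [ bound i , bound (suc i) ) partition ω; the block after bound i reaches past C (bound i).
module Blocks (C : ℕ → ℕ) where

  bound : ℕ → ℕ
  bound zero = 0
  bound (suc i) = suc (bound i) ⊔ C (bound i)

  bound-<-suc : ∀ i → bound i < bound (suc i)
  bound-<-suc i = m≤m⊔n (suc (bound i)) (C (bound i))

  C-≤-bound-suc : ∀ i → C (bound i) ≤ bound (suc i)
  C-≤-bound-suc i = m≤n⊔m (suc (bound i)) (C (bound i))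

  bound-mono : ∀ {i j} → i ≤ j → bound i ≤ bound j
  bound-mono {j = zero} z≤n = ≤-refl
  bound-mono {i} {suc j} i≤1+j with m≤n⇒m<n∨m≡n i≤1+j
  ... | inj₁ i<1+j = ≤-trans (bound-mono (≤-pred i<1+j)) (<⇒≤ (bound-<-suc j))
  ... | inj₂ refl = ≤-refl

  ≤-bound : ∀ i → i ≤ bound i
  ≤-bound zero = z≤n
  ≤-bound (suc i) = ≤-trans (s≤s (≤-bound i)) (bound-<-suc i)

  InBlock : ℕ → ℕ → Set
  InBlock i x = bound i ≤ x × x < bound (suc i)

  InBlock-unique : ∀ {i j x} → InBlock i x → InBlock j x → i ≡ j
  InBlock-unique {i} {j} (lo-i , hi-i) (lo-j , hi-j) with <-cmp i j
  ... | tri< i<j _ _ = ⊥-elim (<⇒≱ hi-i (≤-trans (bound-mono i<j) lo-j))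
  ... | tri≈ _ i≡j _ = i≡j
  ... | tri> _ _ j<i = ⊥-elim (<⇒≱ hi-j (≤-trans (bound-mono j<i) lo-i))

  beyond-block : ∀ {i x} → ¬ InBlock i x → bound i ≤ x → C (bound i) ≤ x
  beyond-block {i} {x} ∉block lo = ≤-trans (C-≤-bound-suc i) (≮⇒≥ (λ hi → ∉block (lo , hi)))

module UltrafilterProperties {F : Subset → Set} (isUF : IsUltrafilter F) where
  open IsUltrafilter isUF public

  ⋂<-∈ : ∀ N Z → (∀ i → i < N → F (Z i)) → F (⋂< N Z)
  ⋂<-∈ zero Z _ = full∈
  ⋂<-∈ (suc N) Z Z∈ = inter _ _ (⋂<-∈ N Z (λ i i<N → Z∈ i (m<n⇒m<1+n i<N))) (Z∈ N ≤-refl)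

  below-∉ : ∀ k → ¬ F (below k)
  below-∉ zero below∈ = empty∉ (upward _ _ below∈ (λ n n<0 → ⊥-elim (n≮0 (does-true⇒ (n <? 0) n<0))))
  below-∉ (suc k) below∈ with ultra (below k)
  ... | inj₁ below-k∈ = below-∉ k below-k∈
  ... | inj₂ above-k∈ = nonPrinc k (upward _ _ (inter _ _ below∈ above-k∈) ⊆singleton)
    where
    ⊆singleton : (below (suc k) ∩ˢ compl (below k)) ⊆ˢ singleton k
    ⊆singleton n n∈ with ∧-true⁻ {below (suc k) n} n∈
    ... | n<1+k , n≮k = dec-true (k ≟ n) (≤-antisym
      (≮⇒≥ (does-not⇒¬ (n <? k) n≮k)) (≤-pred (does-true⇒ (n <? suc k) n<1+k)))

  compl-singleton-∈ : ∀ m → F (compl (singleton m))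
  compl-singleton-∈ m with ultra (singleton m)
  ... | inj₁ singleton∈ = ⊥-elim (nonPrinc m singleton∈)
  ... | inj₂ compl∈ = compl∈

  ∈⇒nonempty : ExcludedMiddle 0ℓ → ∀ a → F a → ∃[ x ] x ∈ˢ a
  ∈⇒nonempty em a a∈ with em {∃[ x ] x ∈ˢ a}
  ... | yes nonempty = nonempty
  ... | no empty = ⊥-elim (empty∉ (upward _ _ a∈ (λ x x∈a → ⊥-elim (empty (x , x∈a)))))

  record Diagonal (W : ℕ → Subset) : Set₁ where
    field
      X : Subset
      X∈ : F X
      K : ℕ → ℕ
      ≤K : ∀ m → m ≤ K m
      X⊆W : ∀ m x → x ∈ˢ X → K m ≤ x → x ∈ˢ W (K m)

  -- Split ω into the even-numbered and the odd-numbered blocks; whichever half lies in F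
  -- skips one block in each pair, and past a skipped block everything lies in the next W.
  diagonalise : ExcludedMiddle 0ℓ → (A : Subset) → F A → (W : ℕ → Subset) →
    (∀ j → ∃[ C ] (∀ x → x ∈ˢ A → C ≤ x → x ∈ˢ W j)) → Diagonal W
  diagonalise em A A∈ W eventually = [ evenCase , oddCase ]′ (ultra evenBlocks)
    where
    open Blocks (λ j → proj₁ (eventually j))

    evenBlocks : Subset
    evenBlocks x = does (em {∃[ j ] InBlock (j * 2) x})

    skipping : (X : Subset) → F X → X ⊆ˢ A → (h : ℕ → ℕ) → (∀ m → m ≤ h m) →
      (∀ m x → x ∈ˢ X → ¬ InBlock (h m) x) → Diagonal W
    skipping X X∈ X⊆A h ≤h skips = record
      { X = X ; X∈ = X∈ ; K = bound ∘ h
      ; ≤K = λ m → ≤-trans (≤h m) (≤-bound (h m))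
      ; X⊆W = λ m x x∈X lo →
          proj₂ (eventually (bound (h m))) x (X⊆A x x∈X) (beyond-block {h m} (skips m x x∈X) lo) }

    oddSkipped : ∀ m x → x ∈ˢ (A ∩ˢ evenBlocks) → ¬ InBlock (suc (m * 2)) x
    oddSkipped m x x∈ inOdd with does-true⇒ em (proj₂ (∧-true⁻ {A x} x∈))
    ... | j , inEven = 0≢1 (begin
      0                   ≡⟨ m*n%n≡0 j 2 ⟨
      j * 2 % 2           ≡⟨ cong (_% 2) (InBlock-unique {j * 2} {suc (m * 2)} inEven inOdd) ⟩
      suc (m * 2) % 2     ≡⟨ [m+kn]%n≡m%n 1 m 2 ⟩
      1                   ∎)
      where open ≡-Reasoning
            0≢1 : ¬ 0 ≡ 1
            0≢1 ()

    evenSkipped : ∀ m x → x ∈ˢ (A ∩ˢ compl evenBlocks) → ¬ InBlock (m * 2) x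
    evenSkipped m x x∈ inEven = does-not⇒¬ em (proj₂ (∧-true⁻ {A x} x∈)) (m , inEven)

    evenCase : F evenBlocks → Diagonal W
    evenCase even∈ = skipping (A ∩ˢ evenBlocks) (inter _ _ A∈ even∈) (λ x x∈ → proj₁ (∧-true⁻ {A x} x∈))
      (λ m → suc (m * 2)) (λ m → m≤n⇒m≤1+n (m≤m*n m 2)) oddSkipped

    oddCase : F (compl evenBlocks) → Diagonal W
    oddCase odd∈ = skipping (A ∩ˢ compl evenBlocks) (inter _ _ A∈ odd∈) (λ x x∈ → proj₁ (∧-true⁻ {A x} x∈))
      (λ m → m * 2) (λ m → m≤m*n m 2) evenSkipped

module Construction (em : ExcludedMiddle 0ℓ) {V U : Subset → Set} (pV : IsPPoint V) (uU : IsUltrafilter U)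
  (φ : Subset → Subset) (φ∈ : MapsInto V U φ) (mono : MonotoneOn V φ) (cof : CofinalIn V U φ) where

  module 𝒱 = UltrafilterProperties (proj₁ pV)
  module 𝒰 = UltrafilterProperties uU

  _∪ᶠ_ : ℕ → Subset → Subset
  (c ∪ᶠ Y) x = bit c x ∨ Y x

  Escape : ℕ → ℕ → Set
  Escape c m = Σ Subset λ Y → V Y × ¬ m ∈ˢ φ (c ∪ᶠ Y)

  escape : ℕ → ℕ → Subset
  escape c m = choice full (em {Escape c m})

  escape-∈ : ∀ c m → V (escape c m)
  escape-∈ c m = choice-preserves V 𝒱.full∈ (λ _ → proj₁) (em {Escape c m})

  escape-∉ : ∀ c m → Escape c m → ¬ m ∈ˢ φ (c ∪ᶠ escape c m)
  escape-∉ c m escapes = proj₂ (choice-correct (em {Escape c m}) escapes)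

  W : ℕ → Subset
  W k = ⋂< (2 ^ k) λ c → ⋂< (suc k) λ m → escape c m

  W-∈ : ∀ k → V (W k)
  W-∈ k = 𝒱.⋂<-∈ (2 ^ k) _ λ c _ → 𝒱.⋂<-∈ (suc k) _ λ m _ → escape-∈ c m

  W⊆escape : ∀ k x → x ∈ˢ W k → ∀ c → c < 2 ^ k → ∀ m → m ≤ k → x ∈ˢ escape c m
  W⊆escape k x x∈W c c<2^k m m≤k =
    ∈-⋂< (suc k) (escape c) x (∈-⋂< (2 ^ k) _ x x∈W c c<2^k) m (s≤s m≤k)

  g : ℕ → ℕ
  g x = firstFalse (λ k → W k x) x

  g-notConstant : ∀ A → V A → ¬ ConstantOn A g
  g-notConstant A A∈ (c , g≡c) = 𝒱.below-∉ (suc c) (𝒱.upward _ _ (𝒱.inter _ _ A∈ (W-∈ c)) ⊆below)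
    where
    ⊆below : (A ∩ˢ W c) ⊆ˢ below (suc c)
    ⊆below x x∈ with ∧-true⁻ {A x} x∈ | x ≤? c
    ... | _ | yes x≤c = dec-true (x <? suc c) (s≤s x≤c)
    ... | x∈A , x∈Wc | no x≰c with trans (sym x∈Wc)
            (subst (λ k → W k x ≡ false) (g≡c x x∈A)
              (firstFalse-found (λ k → W k x) x (subst (_< x) (sym (g≡c x x∈A)) (≰⇒> x≰c))))
    ... | ()

  W-eventually : ∀ A → FiniteToOneOn A g → ∀ j → ∃[ C ] (∀ x → x ∈ˢ A → C ≤ x → x ∈ˢ W j)
  W-eventually A fto j with finiteToOne⇒bounded fto j
  ... | C , bounded = C , λ x x∈A C≤x →
    firstFalse-minimal (λ k → W k x) x j (≰⇒> λ gx≤j → <⇒≱ (bounded x x∈A gx≤j) C≤x)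

  diagonal : 𝒱.Diagonal W
  diagonal with proj₂ pV g
  ... | A , A∈ , inj₁ fto = 𝒱.diagonalise em A A∈ W (W-eventually A fto)
  ... | A , A∈ , inj₂ constant = ⊥-elim (g-notConstant A A∈ constant)

  open 𝒱.Diagonal diagonal

  Forces : ℕ → ℕ → Set
  Forces s m = ∀ a → V a → s ⊆ᶠˢ a → m ∈ˢ φ a

  -- If m ∉ φ a' then a' ⊇ c is an escape for (c, m), while a ⊆ c ∪ escape c m because a ⊆ X.
  prefix-forces : ∀ a m → V a → a ⊆ˢ X → m ∈ˢ φ a → Forces (prefixCode a (K m)) m
  prefix-forces a m a∈ a⊆X m∈φa a' a'∈ c⊆a' with em {m ∈ˢ φ a'}
  ... | yes m∈φa' = m∈φa'
  ... | no m∉φa' = ⊥-elim (escape-∉ c m (a' , a'∈ , m∉φ[c∪a'])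
                     (mono a (c ∪ᶠ escape c m) a∈ c∪escape∈ a⊆c∪escape m m∈φa))
    where
    c : ℕ
    c = prefixCode a (K m)
    c∪a'⊆a' : (c ∪ᶠ a') ⊆ˢ a'
    c∪a'⊆a' x x∈ = [ c⊆a' x , (λ x∈a' → x∈a') ]′ (∨-true⁻ x∈)
    m∉φ[c∪a'] : ¬ m ∈ˢ φ (c ∪ᶠ a')
    m∉φ[c∪a'] m∈ = m∉φa' (mono (c ∪ᶠ a') a' (𝒱.upward _ _ a'∈ λ x → ∨-true⁺ʳ) a'∈ c∪a'⊆a' m m∈)
    c∪escape∈ : V (c ∪ᶠ escape c m)
    c∪escape∈ = 𝒱.upward _ _ (escape-∈ c m) λ x → ∨-true⁺ʳ
    a⊆c∪escape : a ⊆ˢ (c ∪ᶠ escape c m)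
    a⊆c∪escape x x∈a with x <? K m
    ... | yes x<K = ∨-true⁺ˡ (∈ᶠ-prefixCode⁺ a (K m) x x<K x∈a)
    ... | no x≮K = ∨-true⁺ʳ (W⊆escape (K m) x (X⊆W m x (a⊆X x x∈a) (≮⇒≥ x≮K))
                     c (prefixCode-< a (K m)) m (≤K m))

  Forcing : ℕ → Set
  Forcing s = ∃[ m ] (s < 2 ^ K m × Forces s m)

  label : ℕ → ℕ
  label s = choice 0 (em {Forcing s})

  label-forced : ∀ s → Forcing s → s < 2 ^ K (label s) × Forces s (label s)
  label-forced s = choice-correct (em {Forcing s})

  -- The empty set would force m into φ c for every c ∈ V, against cofinality at ω ∖ {m}.
  forcing-nonempty : ∀ s → Forcing s → NonEmptyᶠ s
  forcing-nonempty s (m , _ , forces) with em {NonEmptyᶠ s} | cof _ (𝒰.compl-singleton-∈ m)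
  ... | yes nonempty | _ = nonempty
  ... | no empty | c , c∈ , φc⊆ =
    ⊥-elim (does-not⇒¬ (m ≟ m) (φc⊆ m (forces c c∈ λ k k∈s → ⊥-elim (empty (k , k∈s)))) refl)

  label-finiteToOne : FiniteToOneOnP (Minimal Forcing) label
  label-finiteToOne n = 2 ^ K n , λ s min-s label≡n →
    subst (λ m → s < 2 ^ K m) label≡n (proj₁ (label-forced s (proj₁ min-s)))

  minimal-cover : ∀ a → V a → ∀ b → U b → ∃[ s ] (Minimal Forcing s × s ⊆ᶠˢ a × label s ∈ˢ b)
  minimal-cover a a∈ b b∈ with cof b b∈
  ... | c , c∈ , φc⊆b = cover (𝒰.∈⇒nonempty em (φ a₀) (φ∈ a₀ a₀∈))
    where
    a₀ : Subset
    a₀ = a ∩ˢ (c ∩ˢ X)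
    a₀∈ : V a₀
    a₀∈ = 𝒱.inter _ _ a∈ (𝒱.inter _ _ c∈ X∈)
    a₀⊆a : a₀ ⊆ˢ a
    a₀⊆a x x∈ = proj₁ (∧-true⁻ {a x} x∈)
    a₀⊆c : a₀ ⊆ˢ c
    a₀⊆c x x∈ = proj₁ (∧-true⁻ {c x} (proj₂ (∧-true⁻ {a x} x∈)))
    a₀⊆X : a₀ ⊆ˢ X
    a₀⊆X x x∈ = proj₂ (∧-true⁻ {c x} (proj₂ (∧-true⁻ {a x} x∈)))

    cover : ∃[ m ] m ∈ˢ φ a₀ → ∃[ s ] (Minimal Forcing s × s ⊆ᶠˢ a × label s ∈ˢ b)
    cover (m , m∈φa₀) with minimal-⊆ᶠ em Forcing (prefixCode a₀ (K m))
                             (m , prefixCode-< a₀ (K m) , prefix-forces a₀ m a₀∈ a₀⊆X m∈φa₀)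
    ... | t , min-t , t⊆prefix = t , min-t , (λ k k∈t → a₀⊆a k (t⊆a₀ k k∈t)) , label-t∈b
      where
      t⊆a₀ : t ⊆ᶠˢ a₀
      t⊆a₀ k k∈t = proj₂ (∈ᶠ-prefixCode⁻ a₀ (K m) k (t⊆prefix k k∈t))
      label-t∈b : label t ∈ˢ b
      label-t∈b = φc⊆b (label t) (mono a₀ c a₀∈ c∈ a₀⊆c (label t)
        (proj₂ (label-forced t (proj₁ min-t)) a₀ a₀∈ t⊆a₀))

mainTheorem11 : ExcludedMiddle 0ℓ →
    (V U : Subset → Set) → IsPPoint V → IsUltrafilter U →
    (φ : Subset → Subset) → MapsInto V U φ → MonotoneOn V φ → CofinalIn V U φ →
    Σ (ℕ → Set) λ P → Σ (ℕ → ℕ) λ f →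
    (∀ s → P s → NonEmptyᶠ s) ×
    (∀ s t → P s → P t → s ⊆ᶠ t → s ≡ t) ×
    FiniteToOneOnP P f ×
    (∀ a → V a → ∀ b → U b → ∃[ s ] (P s × s ⊆ᶠˢ a × f s ∈ˢ b))
mainTheorem11 em V U pV uU φ φ∈ mono cof =
  Minimal Forcing , label ,
  (λ s min-s → forcing-nonempty s (proj₁ min-s)) ,
  (λ s t min-s min-t s⊆t → proj₂ min-t s (proj₁ min-s) s⊆t) ,
  label-finiteToOne ,
  minimal-cover
  where open Construction em pV uU φ φ∈ mono cof
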